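{- Let $n\geq 2$ and let $x_1,x_2,x_3\in\mathbb Z$ with $\gcd(x_i,n)=1$ for all $i\in[1,3]$. If $(kx_1)_n+(kx_2)_n+(kx_3)_n>n$ for every $k\in[1,n-1]$, then $x_i+x_j\equiv 0\pmod n$ for some distinct $i,j\in[1,3]$.
   Context: $[x,y]=\{z\in\mathbb Z:x\le z\le y\}$. For an integer $x$, $(x)_n\in[0,n-1]$ denotes the least non-negative residue of $x$ modulo $n$. -}

module Defs where

open import Data.Nat using (ℕ; zero; suc)
open import Data.Integer using (ℤ)
open import Data.Integer.DivMod using (_%ℕ_)

-- (x)_n : the least non-negative residue of x modulo n (for n ≥ 1).
-- For n = 0 (never used, since the statement assumes n ≥ 2) we return 0.
res : ℤ → ℕ → ℕ
res x zero    = zero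
res x (suc m) = x %ℕ suc m

-- Multiplying by an inverse λ′ of −x₁ modulo n normalises x₁ to −1. The hypothesis then says that
-- u = (λ′x₂)_n and v = (λ′x₃)_n satisfy j < (ju)_n + (jv)_n for 0 < j < n, and the claim becomes
-- u = 1, v = 1 or u + v = n. This is proved by strong induction on n. Otherwise c = n + 1 − u − v ≥ 2
-- completes a triple x + y + z = n + 1 of which every pair has the property, with z the largest entry.
-- If x + y ≠ z, reducing modulo z with r ≡ −n yields the pair (x, r) for the smaller modulus z, which the
-- induction hypothesis rules out. If x + y = z, then z inverts 2 and scaling by −2 gives the triple
-- (2, 2x − 1, 2y − 1) of the first kind, unless y = x + 1, which the index j = n − 3 refutes directly.
module Submission where

open import Defs

open import Data.Nat
open import Data.Nat.Properties
open import Data.Nat.DivMod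
open import Data.Nat.Divisibility
  using (_∣_; divides; m%n≡0⇒n∣m; n∣m⇒m%n≡0; m∣m*n; n∣m*n; n∣n; ∣m+n∣m⇒∣n; ∣n⇒∣m*n; ∣⇒≤)
open import Data.Nat.Induction using (<-rec)
open import Data.Nat.Tactic.RingSolver using (solve-∀)
open import Data.Empty using (⊥; ⊥-elim)
open import Data.Product using (∃; _,_; _×_)
open import Data.Sum using (_⊎_; inj₁; inj₂; [_,_]′)
import Data.Sum as Sum
open import Function.Base using (_∘_)
open import Induction.WellFounded using (WfRec)
open import Relation.Binary.PropositionalEquality
open import Relation.Nullary using (¬_; yes; no)

m+pn≡r+qn⇒m%n≡r : ∀ {m r} n .{{_ : NonZero n}} p q → r < n → m + p * n ≡ r + q * n → m % n ≡ r
m+pn≡r+qn⇒m%n≡r {m} {r} n p q r<n eq = begin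
  m % n           ≡⟨ [m+kn]%n≡m%n m p n ⟨
  (m + p * n) % n ≡⟨ cong (_% n) eq ⟩
  (r + q * n) % n ≡⟨ [m+kn]%n≡m%n r q n ⟩
  r % n           ≡⟨ m<n⇒m%n≡m r<n ⟩
  r               ∎
  where open ≡-Reasoning

∣-below-double : ∀ {d m} → d ∣ m → m < d + d → m ≡ 0 ⊎ m ≡ d
∣-below-double {d} (divides zero refl) m<2d = inj₁ refl
∣-below-double {d} (divides (suc zero) refl) m<2d = inj₂ (+-identityʳ d)
∣-below-double {d} (divides (suc (suc q)) refl) m<2d =
  ⊥-elim (<-irrefl refl (<-≤-trans m<2d (+-monoʳ-≤ d (m≤m+n d (q * d)))))

-- Pairs exceeding the diagonal

module _ (n : ℕ) .{{_ : NonZero n}} where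

  -- The hypothesis of the theorem for the triple (−1, u, v), as (−j)_n = n − j.
  Exceeds : ℕ → ℕ → Set
  Exceeds u v = ∀ j → 0 < j → j < n → j < (j * u) % n + (j * v) % n

  Exceeds-sym : ∀ {u v} → Exceeds u v → Exceeds v u
  Exceeds-sym {u} {v} h j 0<j j<n = subst (j <_) (+-comm ((j * u) % n) ((j * v) % n)) (h j 0<j j<n)

  ∣a+b⇒a%n+b%n≡0⊎n : ∀ a b → n ∣ a + b → a % n + b % n ≡ 0 ⊎ a % n + b % n ≡ n
  ∣a+b⇒a%n+b%n≡0⊎n a b n∣a+b = ∣-below-double (m%n≡0⇒n∣m _ n [a%n+b%n]%n≡0) (+-mono-< (m%n<n a n) (m%n<n b n))
    where
    [a%n+b%n]%n≡0 : (a % n + b % n) % n ≡ 0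
    [a%n+b%n]%n≡0 = trans (sym (%-distribˡ-+ a b n)) (n∣m⇒m%n≡0 (a + b) n n∣a+b)

  ∣a+b⇒a%n+b%n≡n : ∀ a b → n ∣ a + b → 0 < a % n → a % n + b % n ≡ n
  ∣a+b⇒a%n+b%n≡n a b n∣a+b 0<a%n with ∣a+b⇒a%n+b%n≡0⊎n a b n∣a+b
  ... | inj₂ sum≡n = sum≡n
  ... | inj₁ sum≡0 = ⊥-elim (<⇒≢ 0<a%n (sym (m+n≡0⇒m≡0 (a % n) sum≡0)))

  n∣jv+[n∸j]v : ∀ j v → j ≤ n → n ∣ j * v + (n ∸ j) * v
  n∣jv+[n∸j]v j v j≤n = subst (n ∣_) (begin
    n * v                ≡⟨ cong (_* v) (m+[n∸m]≡n j≤n) ⟨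
    (j + (n ∸ j)) * v    ≡⟨ *-distribʳ-+ v j (n ∸ j) ⟩
    j * v + (n ∸ j) * v  ∎) (m∣m*n v)
    where open ≡-Reasoning

  0<n∸j<n : ∀ {j} → 0 < j → j < n → 0 < n ∸ j × n ∸ j < n
  0<n∸j<n {j} 0<j j<n = m<n⇒0<n∸m j<n , ∸-monoʳ-< 0<j (<⇒≤ j<n)

  Exceeds⇒residue>0 : ∀ {u v} → Exceeds u v → ∀ j → 0 < j → j < n → 0 < (j * u) % n
  Exceeds⇒residue>0 {u} {v} h j 0<j j<n with 0<n∸j<n 0<j j<n
  ... | 0<j' , j'<n = n≢0⇒n>0 λ ju%n≡0 → <-irrefl refl (begin-strict
    n                          ≡⟨ m+[n∸m]≡n (<⇒≤ j<n) ⟨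
    j + j'                     <⟨ +-mono-< (below j 0<j j<n ju%n≡0) (below j' 0<j' j'<n (j'u%n≡0 ju%n≡0)) ⟩
    (j * v) % n + (j' * v) % n ≤⟨ sum≤n ⟩
    n                          ∎)
    where
    open ≤-Reasoning
    j' = n ∸ j
    below : ∀ i → 0 < i → i < n → (i * u) % n ≡ 0 → i < (i * v) % n
    below i 0<i i<n iu%n≡0 = subst (λ x → i < x + (i * v) % n) iu%n≡0 (h i 0<i i<n)
    j'u%n≡0 : (j * u) % n ≡ 0 → (j' * u) % n ≡ 0
    j'u%n≡0 ju%n≡0 with ∣a+b⇒a%n+b%n≡0⊎n (j * u) (j' * u) (n∣jv+[n∸j]v j u (<⇒≤ j<n))
    ... | inj₁ sum≡0 = trans (cong (_+ (j' * u) % n) (sym ju%n≡0)) sum≡0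
    ... | inj₂ sum≡n = ⊥-elim (<⇒≢ (m%n<n (j' * u) n) (trans (cong (_+ (j' * u) % n) (sym ju%n≡0)) sum≡n))
    sum≤n : (j * v) % n + (j' * v) % n ≤ n
    sum≤n with ∣a+b⇒a%n+b%n≡0⊎n (j * v) (j' * v) (n∣jv+[n∸j]v j v (<⇒≤ j<n))
    ... | inj₁ sum≡0 = subst (_≤ n) (sym sum≡0) z≤n
    ... | inj₂ sum≡n = ≤-reflexive sum≡n

  Exceeds⇒residue-sum<n+j : ∀ {u v} → Exceeds u v → ∀ j → 0 < j → j < n → (j * u) % n + (j * v) % n < n + j
  Exceeds⇒residue-sum<n+j {u} {v} h j 0<j j<n with 0<n∸j<n 0<j j<n
  ... | 0<j' , j'<n = +-cancelʳ-< j' _ _ (begin-strict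
    X + Y + j'                 <⟨ +-monoʳ-< (X + Y) (h j' 0<j' j'<n) ⟩
    X + Y + (X' + Y')          ≡⟨ +-interchange X Y X' Y' ⟩
    (X + X') + (Y + Y')        ≡⟨ cong₂ _+_ (∣a+b⇒a%n+b%n≡n (j * u) (j' * u) (n∣jv+[n∸j]v j u (<⇒≤ j<n)) (Exceeds⇒residue>0 h j 0<j j<n))
                                            (∣a+b⇒a%n+b%n≡n (j * v) (j' * v) (n∣jv+[n∸j]v j v (<⇒≤ j<n)) (Exceeds⇒residue>0 (Exceeds-sym h) j 0<j j<n)) ⟩
    n + n                      ≡⟨ cong (n +_) (m+[n∸m]≡n (<⇒≤ j<n)) ⟨
    n + (j + j')               ≡⟨ +-assoc n j j' ⟨
    n + j + j'                 ∎)
    where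
    open ≤-Reasoning
    j' = n ∸ j
    X = (j * u) % n
    Y = (j * v) % n
    X' = (j' * u) % n
    Y' = (j' * v) % n
    +-interchange : ∀ a b c d → a + b + (c + d) ≡ (a + c) + (b + d)
    +-interchange = solve-∀

  Exceeds⇒residue-sum≡n+k : ∀ {u v} c → Exceeds u v → u + v + c ≡ suc n → ∀ k → 0 < k → k < n →
                         (k * u) % n + (k * v) % n + (k * c) % n ≡ n + k
  Exceeds⇒residue-sum≡n+k {u} {v} c h u+v+c≡1+n k 0<k k<n =
    subst (λ z → X + Y + z ≡ n + k) (sym kc%n≡R) (m+[n∸m]≡n (<⇒≤ X+Y<n+k))
    where
    X = (k * u) % n
    Y = (k * v) % n
    P = (k * u) / n
    Q = (k * v) / n
    X+Y<n+k : X + Y < n + k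
    X+Y<n+k = Exceeds⇒residue-sum<n+j h k 0<k k<n
    R = (n + k) ∸ (X + Y)
    R<n : R < n
    R<n = +-cancelˡ-< (X + Y) R n (begin-strict
      X + Y + R   ≡⟨ m+[n∸m]≡n (<⇒≤ X+Y<n+k) ⟩
      n + k       <⟨ +-monoʳ-< n (h k 0<k k<n) ⟩
      n + (X + Y) ≡⟨ +-comm n (X + Y) ⟩
      X + Y + n   ∎)
      where open ≤-Reasoning
    kc+[1+P+Q]n≡R+kn : k * c + (1 + (P + Q)) * n ≡ R + k * n
    kc+[1+P+Q]n≡R+kn = +-cancelˡ-≡ (X + Y) _ _ (begin
      (X + Y) + (k * c + (1 + (P + Q)) * n) ≡⟨ regroup X Y P Q n (k * c) ⟩
      ((X + P * n) + (Y + Q * n) + k * c) + n ≡⟨ cong₂ (λ a b → (a + b + k * c) + n)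
                                                       (m≡m%n+[m/n]*n (k * u) n) (m≡m%n+[m/n]*n (k * v) n) ⟨
      (k * u + k * v + k * c) + n            ≡⟨ cong (_+ n) (k*[a+b+c] k u v c) ⟨
      k * (u + v + c) + n                    ≡⟨ cong (λ z → k * z + n) u+v+c≡1+n ⟩
      k * (1 + n) + n                        ≡⟨ k*[1+n]+n k n ⟩
      (n + k) + k * n                        ≡⟨ cong (_+ k * n) (m+[n∸m]≡n (<⇒≤ X+Y<n+k)) ⟨
      (X + Y + R) + k * n                    ≡⟨ +-assoc (X + Y) R (k * n) ⟩
      (X + Y) + (R + k * n)                  ∎)
      where
      open ≡-Reasoning
      regroup : ∀ x y p q n c → (x + y) + (c + (1 + (p + q)) * n) ≡ ((x + p * n) + (y + q * n) + c) + n
      regroup = solve-∀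
      k*[a+b+c] : ∀ k a b c → k * (a + b + c) ≡ k * a + k * b + k * c
      k*[a+b+c] = solve-∀
      k*[1+n]+n : ∀ k n → k * (1 + n) + n ≡ (n + k) + k * n
      k*[1+n]+n = solve-∀
    kc%n≡R : (k * c) % n ≡ R
    kc%n≡R = m+pn≡r+qn⇒m%n≡r n (1 + (P + Q)) k R<n kc+[1+P+Q]n≡R+kn

  Exceeds-third : ∀ {u v} c → Exceeds u v → u + v + c ≡ suc n → Exceeds u c
  Exceeds-third {u} {v} c h u+v+c≡1+n k 0<k k<n = +-cancelʳ-< Y k (X + Z) (begin-strict
      k + Y     <⟨ +-monoʳ-< k (m%n<n (k * v) n) ⟩
      k + n     ≡⟨ +-comm k n ⟩
      n + k     ≡⟨ Exceeds⇒residue-sum≡n+k c h u+v+c≡1+n k 0<k k<n ⟨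
      X + Y + Z ≡⟨ +-assoc X Y Z ⟩
      X + (Y + Z) ≡⟨ cong (X +_) (+-comm Y Z) ⟩
      X + (Z + Y) ≡⟨ +-assoc X Z Y ⟨
      X + Z + Y ∎)
    where
    open ≤-Reasoning
    X = (k * u) % n
    Y = (k * v) % n
    Z = (k * c) % n

-- Descent to a smaller modulus

descent-index : ∀ n z r t .{{_ : NonZero n}} .{{_ : NonZero z}} → z ≤ n → z ∣ n + r → 0 < t → t < z →
                ∃ λ j → 0 < j × j < n × j * z ≡ t * n + (t * r) % z
descent-index n z r t z≤n' z∣n+r 0<t t<z = j , 0<j , j<n , jz≡tn+e
  where
  e = (t * r) % z
  z∣tn+e : z ∣ t * n + e
  z∣tn+e = ∣m+n∣m⇒∣n (subst (z ∣_) t[n+r]≡ (∣n⇒∣m*n t z∣n+r)) (n∣m*n ((t * r) / z))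
    where
    t[n+r]≡ : t * (n + r) ≡ (t * r) / z * z + (t * n + e)
    t[n+r]≡ = begin
      t * (n + r)                      ≡⟨ *-distribˡ-+ t n r ⟩
      t * n + t * r                    ≡⟨ cong (t * n +_) (m≡m%n+[m/n]*n (t * r) z) ⟩
      t * n + (e + (t * r) / z * z)    ≡⟨ rearrange (t * n) e ((t * r) / z * z) ⟩
      (t * r) / z * z + (t * n + e)    ∎
      where
      open ≡-Reasoning
      rearrange : ∀ a b c → a + (b + c) ≡ c + (a + b)
      rearrange = solve-∀
  j = (t * n + e) / z
  jz≡tn+e : j * z ≡ t * n + e
  jz≡tn+e = m/n*n≡m z∣tn+e
  0<j : 0 < j
  0<j = *-cancelʳ-< z 0 j (subst (0 <_) (sym jz≡tn+e) (<-≤-trans (*-mono-< 0<t (>-nonZero⁻¹ n)) (m≤m+n (t * n) e)))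
  j<n : j < n
  j<n = *-cancelʳ-< z j n (begin-strict
    j * z     ≡⟨ jz≡tn+e ⟩
    t * n + e <⟨ +-monoʳ-< (t * n) (m%n<n (t * r) z) ⟩
    t * n + z ≤⟨ +-monoʳ-≤ (t * n) z≤n' ⟩
    t * n + n ≡⟨ +-comm (t * n) n ⟩
    suc t * n ≤⟨ *-monoˡ-≤ n t<z ⟩
    z * n     ≡⟨ *-comm z n ⟩
    n * z     ∎)
    where open ≤-Reasoning

-- (jy)_n z is the remainder of (ty)_z n + e y modulo n z.
[jy]%n*z≤[ty]%z*n+ey : ∀ n z y j t e .{{_ : NonZero n}} .{{_ : NonZero z}} → j * z ≡ t * n + e →
                       ((j * y) % n) * z ≤ ((t * y) % z) * n + e * y
[jy]%n*z≤[ty]%z*n+ey n z y j t e jz≡tn+e =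
  subst (_≤ ρ * n + e * y) (m+pn≡r+qn⇒m%n≡r (n * z) G B (*-monoˡ-< z (m%n<n (j * y) n)) (sym Az≡))
    (m%n≤m (ρ * n + e * y) (n * z))
  where
  instance _ = m*n≢0 n z
  ρ = (t * y) % z
  A = (j * y) % n
  B = (j * y) / n
  G = (t * y) / z
  Az≡ : A * z + B * (n * z) ≡ (ρ * n + e * y) + G * (n * z)
  Az≡ = begin
    A * z + B * (n * z)            ≡⟨ expand₁ A B n z ⟨
    (A + B * n) * z                ≡⟨ cong (_* z) (m≡m%n+[m/n]*n (j * y) n) ⟨
    (j * y) * z                    ≡⟨ swap j y z ⟩
    y * (j * z)                    ≡⟨ cong (y *_) jz≡tn+e ⟩
    y * (t * n + e)                ≡⟨ distrib y t n e ⟩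
    (t * y) * n + e * y            ≡⟨ cong (λ w → w * n + e * y) (m≡m%n+[m/n]*n (t * y) z) ⟩
    (ρ + G * z) * n + e * y        ≡⟨ expand₂ ρ G z n e y ⟩
    (ρ * n + e * y) + G * (n * z)  ∎
    where
    open ≡-Reasoning
    expand₁ : ∀ a b n z → (a + b * n) * z ≡ a * z + b * (n * z)
    expand₁ = solve-∀
    swap : ∀ j y z → (j * y) * z ≡ y * (j * z)
    swap = solve-∀
    distrib : ∀ y t n e → y * (t * n + e) ≡ (t * y) * n + e * y
    distrib = solve-∀
    expand₂ : ∀ ρ g z n e y → (ρ + g * z) * n + e * y ≡ (ρ * n + e * y) + g * (n * z)
    expand₂ = solve-∀

-- A failure (ty)_z + (tr)_z ≤ t modulo z lifts to the failure at j = (tn + (tr)_z)/z modulo n.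
Exceeds-descend : ∀ n .{{_ : NonZero n}} z y r .{{_ : NonZero z}} → z + y ≤ n → z ∣ n + r →
                  Exceeds n y z → Exceeds z y r
Exceeds-descend n z y r z+y≤n z∣n+r h t 0<t t<z with t <? (t * y) % z + (t * r) % z
... | yes t<sum = t<sum
... | no t≮sum with descent-index n z r t (≤-trans (m≤m+n z y) z+y≤n) z∣n+r 0<t t<z
...   | j , 0<j , j<n , jz≡tn+e = ⊥-elim (<-irrefl refl (<-≤-trans (h j 0<j j<n) A+jz%n≤j))
  where
  ρ = (t * y) % z
  e = (t * r) % z
  A = (j * y) % n
  jz%n≡e : (j * z) % n ≡ e
  jz%n≡e = m+pn≡r+qn⇒m%n≡r n 0 t (<-≤-trans (m%n<n (t * r) z) (≤-trans (m≤m+n z y) z+y≤n))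
             (trans (+-identityʳ (j * z)) (trans jz≡tn+e (+-comm (t * n) e)))
  [A+e]z≤jz : (A + e) * z ≤ j * z
  [A+e]z≤jz = begin
    (A + e) * z             ≡⟨ *-distribʳ-+ z A e ⟩
    A * z + e * z           ≤⟨ +-monoˡ-≤ (e * z) ([jy]%n*z≤[ty]%z*n+ey n z y j t e jz≡tn+e) ⟩
    ρ * n + e * y + e * z   ≡⟨ +-assoc (ρ * n) (e * y) (e * z) ⟩
    ρ * n + (e * y + e * z) ≡⟨ cong (ρ * n +_) (*-distribˡ-+ e y z) ⟨
    ρ * n + e * (y + z)     ≤⟨ +-monoʳ-≤ (ρ * n) (*-monoʳ-≤ e (subst (_≤ n) (+-comm z y) z+y≤n)) ⟩
    ρ * n + e * n           ≡⟨ *-distribʳ-+ n ρ e ⟨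
    (ρ + e) * n             ≤⟨ *-monoˡ-≤ n (≮⇒≥ t≮sum) ⟩
    t * n                   ≤⟨ m≤m+n (t * n) e ⟩
    t * n + e               ≡⟨ jz≡tn+e ⟨
    j * z                   ∎
    where open ≤-Reasoning
  A+jz%n≤j : A + (j * z) % n ≤ j
  A+jz%n≤j = subst (λ x → A + x ≤ j) (sym jz%n≡e) (*-cancelʳ-≤ (A + e) j z [A+e]z≤jz)

∃-complement-mod : ∀ m z .{{_ : NonZero z}} → ∃ λ r → r < z × z ∣ m + r
∃-complement-mod m z with m % z in m%z≡
... | zero = 0 , >-nonZero⁻¹ z , m%n≡0⇒n∣m (m + 0) z (trans (cong (_% z) (+-identityʳ m)) m%z≡)
... | suc k = z ∸ suc k , ∸-monoʳ-< z<s 1+k≤z , divides (suc (m / z)) (begin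
    m + (z ∸ suc k)                     ≡⟨ cong (_+ (z ∸ suc k)) (m≡m%n+[m/n]*n m z) ⟩
    m % z + m / z * z + (z ∸ suc k)     ≡⟨ cong (λ w → w + m / z * z + (z ∸ suc k)) m%z≡ ⟩
    suc k + m / z * z + (z ∸ suc k)     ≡⟨ rearrange (suc k) (m / z * z) (z ∸ suc k) ⟩
    (suc k + (z ∸ suc k)) + m / z * z   ≡⟨ cong (_+ m / z * z) (m+[n∸m]≡n 1+k≤z) ⟩
    z + m / z * z                       ∎)
  where
  open ≡-Reasoning
  1+k≤z : suc k ≤ z
  1+k≤z = <⇒≤ (subst (_< z) m%z≡ (m%n<n m z))
  rearrange : ∀ a b c → a + b + c ≡ (a + c) + b
  rearrange = solve-∀

-- Classification by strong induction on the modulus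

TrivialPair : ℕ → ℕ → ℕ → Set
TrivialPair n u v = u ≡ 1 ⊎ v ≡ 1 ⊎ u + v ≡ n

ExceedsOnlyTrivially : ℕ → Set
ExceedsOnlyTrivially n = .{{_ : NonZero n}} → 2 ≤ n → ∀ u v → u < n → v < n → Exceeds n u v → TrivialPair n u v

reduced-pair-nontrivial : ∀ n x y z r → 2 ≤ x → 2 ≤ y → x < z → y ≤ z → x + y + z ≡ suc n → x + y ≢ z →
                          z ∣ n + r → ¬ TrivialPair z x r
reduced-pair-nontrivial n x y z r 2≤x 2≤y x<z y≤z sum x+y≢z z∣n+r (inj₁ x≡1) = <⇒≢ 2≤x (sym x≡1)
reduced-pair-nontrivial n x y z r 2≤x 2≤y x<z y≤z sum x+y≢z z∣n+r (inj₂ (inj₁ r≡1)) =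
  [ (λ x+y≡0 → <⇒≢ (≤-trans (s≤s z≤n) 2≤x) (sym (m+n≡0⇒m≡0 x x+y≡0))) , x+y≢z ]′
    (∣-below-double z∣x+y (+-mono-<-≤ x<z y≤z))
  where
  n+r≡z+x+y : n + r ≡ z + (x + y)
  n+r≡z+x+y = begin
    n + r       ≡⟨ cong (n +_) r≡1 ⟩
    n + 1       ≡⟨ +-comm n 1 ⟩
    suc n       ≡⟨ sum ⟨
    x + y + z   ≡⟨ +-comm (x + y) z ⟩
    z + (x + y) ∎
    where open ≡-Reasoning
  z∣x+y : z ∣ x + y
  z∣x+y = ∣m+n∣m⇒∣n (subst (z ∣_) n+r≡z+x+y z∣n+r) n∣n
reduced-pair-nontrivial n x (suc y') z r 2≤x (s≤s 1≤y') x<z y'<z sum x+y≢z z∣n+r (inj₂ (inj₂ x+r≡z)) =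
  <-irrefl refl (<-≤-trans y'<z (∣⇒≤ {{>-nonZero 1≤y'}} z∣y'))
  where
  n+r≡z+[z+y'] : n + r ≡ z + (z + y')
  n+r≡z+[z+y'] = begin
    n + r             ≡⟨ cong (_+ r) (suc-injective (trans (sym sum) (cong (_+ z) (+-suc x y')))) ⟩
    x + y' + z + r    ≡⟨ regroup x y' z r ⟩
    (x + r) + y' + z  ≡⟨ cong (λ w → w + y' + z) x+r≡z ⟩
    z + y' + z        ≡⟨ +-comm (z + y') z ⟩
    z + (z + y')      ∎
    where
    open ≡-Reasoning
    regroup : ∀ x y z r → x + y + z + r ≡ (x + r) + y + z
    regroup = solve-∀
  z∣y' : z ∣ y'
  z∣y' = ∣m+n∣m⇒∣n (∣m+n∣m⇒∣n (subst (z ∣_) n+r≡z+[z+y'] z∣n+r) n∣n) n∣n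

unbalanced-triple-impossible : ∀ n .{{_ : NonZero n}} → WfRec _<_ ExceedsOnlyTrivially n →
  ∀ x y z → 2 ≤ x → 2 ≤ y → x ≤ z → y ≤ z → x + y + z ≡ suc n → x + y ≢ z → ¬ Exceeds n x z
unbalanced-triple-impossible n ih x y z 2≤x 2≤y x≤z y≤z sum x+y≢z h with ∃-complement-mod n z {{z≢0}}
  where
  z≢0 : NonZero z
  z≢0 = >-nonZero (≤-trans (s≤s z≤n) (≤-trans 2≤x x≤z))
... | r , r<z , z∣n+r =
  reduced-pair-nontrivial n x y z r 2≤x 2≤y x<z y≤z sum x+y≢z z∣n+r (ih z<n 2≤z x r x<z r<z hz)
  where
  2≤z : 2 ≤ z
  2≤z = ≤-trans 2≤x x≤z
  instance _ = >-nonZero (≤-trans (s≤s z≤n) 2≤z)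
  z+x<n : z + x < n
  z+x<n = ≤-pred (begin
    2 + (z + x) ≡⟨ +-comm 2 (z + x) ⟩
    z + x + 2   ≤⟨ +-monoʳ-≤ (z + x) 2≤y ⟩
    z + x + y   ≡⟨ rotate z x y ⟩
    x + y + z   ≡⟨ sum ⟩
    suc n       ∎)
    where
    open ≤-Reasoning
    rotate : ∀ a b c → a + b + c ≡ b + c + a
    rotate = solve-∀
  z<n : z < n
  z<n = ≤-<-trans (m≤m+n z x) z+x<n
  hz : Exceeds z x r
  hz = Exceeds-descend n z x r (<⇒≤ z+x<n) z∣n+r h
  x<z : x < z
  x<z = ≤∧≢⇒< x≤z λ x≡z → <-irrefl (sym (trans (cong (_% z) (trans (*-identityˡ x) x≡z)) (n%n≡0 z)))
                                     (Exceeds⇒residue>0 z hz 1 z<s 2≤z)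

[kz]%n≡j : ∀ n .{{_ : NonZero n}} z j k → z + z ≡ suc n → n + k ≡ j + j → j < n → (k * z) % n ≡ j
[kz]%n≡j n z j k z+z≡1+n n+k≡j+j j<n = m+pn≡r+qn⇒m%n≡r n z j j<n (begin
  k * z + z * n ≡⟨ distrib k z n ⟩
  (n + k) * z   ≡⟨ cong (_* z) n+k≡j+j ⟩
  (j + j) * z   ≡⟨ regroup j z ⟩
  j * (z + z)   ≡⟨ cong (j *_) z+z≡1+n ⟩
  j * suc n     ≡⟨ *-suc j n ⟩
  j + j * n     ∎)
  where
  open ≡-Reasoning
  distrib : ∀ k z n → k * z + z * n ≡ (n + k) * z
  distrib = solve-∀
  regroup : ∀ j z → (j + j) * z ≡ j * (z + z)
  regroup = solve-∀

[kx]%n+[jw]%n≡n : ∀ n .{{_ : NonZero n}} x w j k → w + (x + x) ≡ n → n + k ≡ j + j → 0 < (k * x) % n →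
                  (k * x) % n + (j * w) % n ≡ n
[kx]%n+[jw]%n≡n n x w j k w+x+x≡n n+k≡j+j 0<kx%n =
  ∣a+b⇒a%n+b%n≡n n (k * x) (j * w) (∣m+n∣m⇒∣n (subst (n ∣_) (sym xn+kx+jw≡jn) (n∣m*n j)) (n∣m*n x)) 0<kx%n
  where
  open ≡-Reasoning
  xn+kx+jw≡jn : x * n + (k * x + j * w) ≡ j * n
  xn+kx+jw≡jn = begin
    x * n + (k * x + j * w) ≡⟨ regroup x n k j w ⟩
    (n + k) * x + j * w     ≡⟨ cong (λ m → m * x + j * w) n+k≡j+j ⟩
    (j + j) * x + j * w     ≡⟨ factor j x w ⟩
    j * (w + (x + x))       ≡⟨ cong (j *_) w+x+x≡n ⟩
    j * n                   ∎
    where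
    regroup : ∀ x n k j w → x * n + (k * x + j * w) ≡ (n + k) * x + j * w
    regroup = solve-∀
    factor : ∀ j x w → (j + j) * x + j * w ≡ j * (w + (x + x))
    factor = solve-∀

-- When x + y = z, z inverts 2 modulo n; index j is paired with k = 2j − n, so that kx ≡ −jw and kz ≡ j.
Exceeds-2 : ∀ n .{{_ : NonZero n}} {x y} z w → Exceeds n x y → x + y ≡ z → z + z ≡ suc n → w + (x + x) ≡ n →
            Exceeds n 2 w
Exceeds-2 n {x} {y} z w h x+y≡z z+z≡1+n w+x+x≡n j 0<j j<n with j + j <? n
... | yes j+j<n = <-≤-trans (subst (j <_) (sym j*2%n≡j+j) (m<m+n j 0<j)) (m≤m+n _ _)
  where
  j*2%n≡j+j : (j * 2) % n ≡ j + j
  j*2%n≡j+j = trans (cong (_% n) (j*2≡j+j j)) (m<n⇒m%n≡m j+j<n)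
    where
    j*2≡j+j : ∀ j → j * 2 ≡ j + j
    j*2≡j+j = solve-∀
... | no j+j≮n = subst (j <_) (cong (_+ (j * w) % n) (sym j*2%n≡k)) (+-cancelˡ-< X j (k + (j * w) % n) X+j<X+[k+jw%n])
  where
  n<j+j : n < j + j
  n<j+j = ≤∧≢⇒< (≮⇒≥ j+j≮n) λ n≡j+j → even≢odd z j (trans (2*m≡m+m z) (trans z+z≡1+n (cong suc (trans n≡j+j (sym (2*m≡m+m j))))))
    where
    2*m≡m+m : ∀ m → 2 * m ≡ m + m
    2*m≡m+m = solve-∀
  k = j + j ∸ n
  n+k≡j+j : n + k ≡ j + j
  n+k≡j+j = m+[n∸m]≡n (<⇒≤ n<j+j)
  0<k : 0 < k
  0<k = m<n⇒0<n∸m n<j+j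
  k<n : k < n
  k<n = +-cancelˡ-< n k n (subst (_< n + n) (sym n+k≡j+j) (+-mono-< j<n j<n))
  j*2%n≡k : (j * 2) % n ≡ k
  j*2%n≡k = m+pn≡r+qn⇒m%n≡r n 0 1 k<n (trans (j*2+0*n≡j+j j n) (trans (sym n+k≡j+j) (n+k≡k+1*n n k)))
    where
    j*2+0*n≡j+j : ∀ j n → j * 2 + 0 * n ≡ j + j
    j*2+0*n≡j+j = solve-∀
    n+k≡k+1*n : ∀ n k → n + k ≡ k + 1 * n
    n+k≡k+1*n = solve-∀
  X = (k * x) % n
  Y = (k * y) % n
  X+j<X+[k+jw%n] : X + j < X + (k + (j * w) % n)
  X+j<X+[k+jw%n] = begin-strict
    X + j                 <⟨ +-monoˡ-< j (m<m+n X (Exceeds⇒residue>0 n (Exceeds-sym n h) k 0<k k<n)) ⟩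
    X + Y + j             ≡⟨ cong (X + Y +_) ([kz]%n≡j n z j k z+z≡1+n n+k≡j+j j<n) ⟨
    X + Y + (k * z) % n   ≡⟨ Exceeds⇒residue-sum≡n+k n z h (trans (cong (_+ z) x+y≡z) z+z≡1+n) k 0<k k<n ⟩
    n + k                 ≡⟨ cong (_+ k) ([kx]%n+[jw]%n≡n n x w j k w+x+x≡n n+k≡j+j (Exceeds⇒residue>0 n h k 0<k k<n)) ⟨
    X + (j * w) % n + k   ≡⟨ +-assoc X ((j * w) % n) k ⟩
    X + ((j * w) % n + k) ≡⟨ cong (X +_) (+-comm ((j * w) % n) k) ⟩
    X + (k + (j * w) % n) ∎
    where open ≤-Reasoning

¬Exceeds-[9+4w]-[2+w]-[3+w] : ∀ w → ¬ Exceeds (9 + 4 * w) (2 + w) (3 + w)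
¬Exceeds-[9+4w]-[2+w]-[3+w] w h = <-irrefl refl (<-≤-trans (h j z<s j<n) sum≤j)
  where
  n = 9 + 4 * w
  j = 6 + 4 * w
  j<n : j < n
  j<n = m+n≤o⇒m≤o (7 + 4 * w) (≤-reflexive (eq₁ w))
    where
    eq₁ : ∀ w → 7 + 4 * w + 2 ≡ 9 + 4 * w
    eq₁ = solve-∀
  j[2+w]%n≡3+w : (j * (2 + w)) % n ≡ 3 + w
  j[2+w]%n≡3+w = m+pn≡r+qn⇒m%n≡r n 0 (1 + w) (m+n≤o⇒m≤o (4 + w) (≤-reflexive (eq₁ w))) (eq₂ w)
    where
    eq₁ : ∀ w → 4 + w + (5 + 3 * w) ≡ 9 + 4 * w
    eq₁ = solve-∀
    eq₂ : ∀ w → (6 + 4 * w) * (2 + w) + 0 * (9 + 4 * w) ≡ 3 + w + (1 + w) * (9 + 4 * w)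
    eq₂ = solve-∀
  j[3+w]%n≡w : (j * (3 + w)) % n ≡ w
  j[3+w]%n≡w = m+pn≡r+qn⇒m%n≡r n 0 (2 + w) (m+n≤o⇒m≤o (1 + w) (≤-reflexive (eq₁ w))) (eq₂ w)
    where
    eq₁ : ∀ w → 1 + w + (8 + 3 * w) ≡ 9 + 4 * w
    eq₁ = solve-∀
    eq₂ : ∀ w → (6 + 4 * w) * (3 + w) + 0 * (9 + 4 * w) ≡ w + (2 + w) * (9 + 4 * w)
    eq₂ = solve-∀
  sum≤j : (j * (2 + w)) % n + (j * (3 + w)) % n ≤ j
  sum≤j = subst (_≤ j) (sym (cong₂ _+_ j[2+w]%n≡3+w j[3+w]%n≡w)) (m+n≤o⇒m≤o (3 + w + w) (≤-reflexive (eq w)))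
    where
    eq : ∀ w → 3 + w + w + (3 + 2 * w) ≡ 6 + 4 * w
    eq = solve-∀

consecutive-balanced-impossible : ∀ n .{{_ : NonZero n}} x → 2 ≤ x → x + suc x + (x + suc x) ≡ suc n →
                                  ¬ Exceeds n x (suc x)
consecutive-balanced-impossible n .(2 + w) (s≤s (s≤s {n = w} _)) sum with n≡9+4w
  where
  n≡9+4w : n ≡ 9 + 4 * w
  n≡9+4w = suc-injective (trans (sym sum) (eq w))
    where
    eq : ∀ w → 2 + w + (3 + w) + (2 + w + (3 + w)) ≡ 10 + 4 * w
    eq = solve-∀
... | refl = ¬Exceeds-[9+4w]-[2+w]-[3+w] w

-- X₂ = 2x − 1 and Y₂ = 2y − 1 are −2y and −2x modulo n.
balanced-triple-impossible : ∀ n .{{_ : NonZero n}} → WfRec _<_ ExceedsOnlyTrivially n →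
  ∀ x y z → 2 ≤ x → 2 ≤ y → x ≤ y → x + y ≡ z → x + y + z ≡ suc n → ¬ Exceeds n x y
balanced-triple-impossible n ih (suc x') (suc y') z (s≤s 1≤x') (s≤s 1≤y') x≤y x+y≡z sum h with suc y' ≟ suc (suc x')
... | yes refl = consecutive-balanced-impossible n (suc x') (s≤s 1≤x')
                   (subst (λ c → suc x' + suc (suc x') + c ≡ suc n) (sym x+y≡z) sum) h
... | no y≢1+x = unbalanced-triple-impossible n ih 2 X₂ Y₂ ≤-refl 2≤X₂ 2≤Y₂ X₂≤Y₂ 2+X₂+Y₂≡1+n 2+X₂≢Y₂
                   (Exceeds-2 n z Y₂ h x+y≡z z+z≡1+n Y₂+[x+x]≡n)
  where
  x = suc x'
  y = suc y'
  X₂ = x + x'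
  Y₂ = y + y'
  2≤X₂ : 2 ≤ X₂
  2≤X₂ = s≤s (≤-trans 1≤x' (m≤m+n x' x'))
  2≤Y₂ : 2 ≤ Y₂
  2≤Y₂ = s≤s (≤-trans 1≤y' (m≤m+n y' y'))
  X₂≤Y₂ : X₂ ≤ Y₂
  X₂≤Y₂ = +-mono-≤ x≤y (≤-pred x≤y)
  z+z≡1+n : z + z ≡ suc n
  z+z≡1+n = trans (cong (_+ z) (sym x+y≡z)) sum
  [x+y]+[x+y]≡1+n : (x + y) + (x + y) ≡ suc n
  [x+y]+[x+y]≡1+n = trans (cong (λ c → c + c) x+y≡z) z+z≡1+n
  2+X₂+Y₂≡1+n : 2 + X₂ + Y₂ ≡ suc n
  2+X₂+Y₂≡1+n = trans (eq x' y') [x+y]+[x+y]≡1+n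
    where
    eq : ∀ x' y' → 2 + (suc x' + x') + (suc y' + y') ≡ (suc x' + suc y') + (suc x' + suc y')
    eq = solve-∀
  Y₂+[x+x]≡n : Y₂ + (x + x) ≡ n
  Y₂+[x+x]≡n = suc-injective (trans (eq x' y') [x+y]+[x+y]≡1+n)
    where
    eq : ∀ x' y' → suc (suc y' + y' + (suc x' + suc x')) ≡ (suc x' + suc y') + (suc x' + suc y')
    eq = solve-∀
  2+X₂≢Y₂ : 2 + X₂ ≢ Y₂
  2+X₂≢Y₂ 2+X₂≡Y₂ = y≢1+x (cong suc (sym (*-cancelˡ-≡ (suc x') y' 2 (suc-injective (trans (sym (eqˡ x')) (trans 2+X₂≡Y₂ (eqʳ y')))))))
    where
    eqˡ : ∀ x' → 2 + (suc x' + x') ≡ suc (2 * suc x')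
    eqˡ = solve-∀
    eqʳ : ∀ y' → suc y' + y' ≡ suc (2 * y')
    eqʳ = solve-∀

triple-with-largest-impossible : ∀ n .{{_ : NonZero n}} → WfRec _<_ ExceedsOnlyTrivially n →
  ∀ x y z → 2 ≤ x → 2 ≤ y → x ≤ z → y ≤ z → x + y + z ≡ suc n → ¬ Exceeds n x y
triple-with-largest-impossible n ih x y z 2≤x 2≤y x≤z y≤z sum h with x + y ≟ z | ≤-total x y
... | no x+y≢z | _ = unbalanced-triple-impossible n ih x y z 2≤x 2≤y x≤z y≤z sum x+y≢z (Exceeds-third n z h sum)
... | yes x+y≡z | inj₁ x≤y = balanced-triple-impossible n ih x y z 2≤x 2≤y x≤y x+y≡z sum h
... | yes x+y≡z | inj₂ y≤x = balanced-triple-impossible n ih y x z 2≤y 2≤x y≤x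
                                 (trans (+-comm y x) x+y≡z) (trans (cong (_+ z) (+-comm y x)) sum) (Exceeds-sym n h)

nontrivial-triple-impossible : ∀ n .{{_ : NonZero n}} → WfRec _<_ ExceedsOnlyTrivially n →
  ∀ a b c → 2 ≤ a → 2 ≤ b → 2 ≤ c → a + b + c ≡ suc n → ¬ Exceeds n a b
nontrivial-triple-impossible n ih a b c 2≤a 2≤b 2≤c sum h with ≤-total a b
... | inj₁ a≤b with ≤-total b c
...   | inj₁ b≤c = triple-with-largest-impossible n ih a b c 2≤a 2≤b (≤-trans a≤b b≤c) b≤c sum h
...   | inj₂ c≤b = triple-with-largest-impossible n ih a c b 2≤a 2≤c a≤b c≤b
                     (trans (swap a c b) sum) (Exceeds-third n c h sum)
  where
  swap : ∀ a c b → a + c + b ≡ a + b + c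
  swap = solve-∀
nontrivial-triple-impossible n ih a b c 2≤a 2≤b 2≤c sum h | inj₂ b≤a with ≤-total a c
...   | inj₁ a≤c = triple-with-largest-impossible n ih a b c 2≤a 2≤b a≤c (≤-trans b≤a a≤c) sum h
...   | inj₂ c≤a = triple-with-largest-impossible n ih b c a 2≤b 2≤c b≤a c≤a
                     (trans (rotate b c a) sum) (Exceeds-third n c (Exceeds-sym n h) (trans (cong (_+ c) (+-comm b a)) sum))
  where
  rotate : ∀ b c a → b + c + a ≡ a + b + c
  rotate = solve-∀

exceeds-only-trivially : ∀ n → ExceedsOnlyTrivially n
exceeds-only-trivially = <-rec ExceedsOnlyTrivially classify
  where
  classify : ∀ n → WfRec _<_ ExceedsOnlyTrivially n → ExceedsOnlyTrivially n
  classify n ih 2≤n u v u<n v<n h with u ≟ 1 | v ≟ 1 | u + v ≟ n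
  ... | yes u≡1 | _       | _         = inj₁ u≡1
  ... | no _    | yes v≡1 | _         = inj₂ (inj₁ v≡1)
  ... | no _    | no _    | yes u+v≡n = inj₂ (inj₂ u+v≡n)
  ... | no u≢1  | no v≢1  | no u+v≢n  =
    ⊥-elim (nontrivial-triple-impossible n ih u v c 2≤u 2≤v (s≤s (m<n⇒0<n∸m u+v<n)) u+v+c≡1+n h)
    where
    1*u%n≡u : (1 * u) % n ≡ u
    1*u%n≡u = trans (cong (_% n) (*-identityˡ u)) (m<n⇒m%n≡m u<n)
    1*v%n≡v : (1 * v) % n ≡ v
    1*v%n≡v = trans (cong (_% n) (*-identityˡ v)) (m<n⇒m%n≡m v<n)
    2≤u : 2 ≤ u
    2≤u = ≤∧≢⇒< (subst (0 <_) 1*u%n≡u (Exceeds⇒residue>0 n h 1 z<s 2≤n)) (u≢1 ∘ sym)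
    2≤v : 2 ≤ v
    2≤v = ≤∧≢⇒< (subst (0 <_) 1*v%n≡v (Exceeds⇒residue>0 n (Exceeds-sym n h) 1 z<s 2≤n)) (v≢1 ∘ sym)
    u+v<n : u + v < n
    u+v<n = ≤∧≢⇒< (≤-pred (subst (u + v <_) (+-comm n 1) u+v<n+1)) u+v≢n
      where
      u+v<n+1 : u + v < n + 1
      u+v<n+1 = subst₂ (λ a b → a + b < n + 1) 1*u%n≡u 1*v%n≡v (Exceeds⇒residue-sum<n+j n h 1 z<s 2≤n)
    c = suc (n ∸ (u + v))
    u+v+c≡1+n : u + v + c ≡ suc n
    u+v+c≡1+n = trans (+-suc (u + v) (n ∸ (u + v))) (cong suc (m+[n∸m]≡n (<⇒≤ u+v<n)))

-- Normalising the first entry to −1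

module _ (N : ℕ) .{{_ : NonZero N}} where

  [m%N*o]%N≡[m*o]%N : ∀ m o → ((m % N) * o) % N ≡ (m * o) % N
  [m%N*o]%N≡[m*o]%N m o = begin
    ((m % N) * o) % N           ≡⟨ %-distribˡ-* (m % N) o N ⟩
    ((m % N % N) * (o % N)) % N ≡⟨ cong (λ c → (c * (o % N)) % N) (m%n%n≡m%n m N) ⟩
    ((m % N) * (o % N)) % N     ≡⟨ %-distribˡ-* m o N ⟨
    (m * o) % N                 ∎
    where open ≡-Reasoning

  [m*[o%N]]%N≡[m*o]%N : ∀ m o → (m * (o % N)) % N ≡ (m * o) % N
  [m*[o%N]]%N≡[m*o]%N m o = begin
    (m * (o % N)) % N ≡⟨ cong (_% N) (*-comm m (o % N)) ⟩
    ((o % N) * m) % N ≡⟨ [m%N*o]%N≡[m*o]%N o m ⟩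
    (o * m) % N       ≡⟨ cong (_% N) (*-comm o m) ⟩
    (m * o) % N       ∎
    where open ≡-Reasoning

  ExceedsTriple : ℕ → ℕ → ℕ → Set
  ExceedsTriple a₁ a₂ a₃ = ∀ k → 1 ≤ k → k < N → N < (k * a₁) % N + (k * a₂) % N + (k * a₃) % N

  [[jl]%N*a]%N≡[j*[la]%N]%N : ∀ j l a → (((j * l) % N) * a) % N ≡ (j * ((l * a) % N)) % N
  [[jl]%N*a]%N≡[j*[la]%N]%N j l a = begin
    (((j * l) % N) * a) % N   ≡⟨ [m%N*o]%N≡[m*o]%N (j * l) a ⟩
    (j * l * a) % N           ≡⟨ cong (_% N) (*-assoc j l a) ⟩
    (j * (l * a)) % N         ≡⟨ [m*[o%N]]%N≡[m*o]%N j (l * a) ⟨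
    (j * ((l * a) % N)) % N   ∎
    where open ≡-Reasoning

  j+[jr]%N≡N : ∀ j r → suc r ≡ N → 0 < j → j < N → j + (j * r) % N ≡ N
  j+[jr]%N≡N j r 1+r≡N 0<j j<N = begin
    j + (j * r) % N      ≡⟨ cong (_+ (j * r) % N) (m<n⇒m%n≡m j<N) ⟨
    j % N + (j * r) % N  ≡⟨ ∣a+b⇒a%n+b%n≡n N j (j * r) N∣j+jr (subst (0 <_) (sym (m<n⇒m%n≡m j<N)) 0<j) ⟩
    N                    ∎
    where
    open ≡-Reasoning
    N∣j+jr : N ∣ j + j * r
    N∣j+jr = subst (N ∣_) (trans (cong (j *_) (sym 1+r≡N)) (*-suc j r)) (n∣m*n j)

  module _ (λ′ a₁ : ℕ) (λ′a₁≡-1 : suc ((λ′ * a₁) % N) ≡ N) where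

    unit-cancel : ∀ s → (λ′ * s) % N ≡ 0 → s % N ≡ 0
    unit-cancel s λ′s%N≡0 = n∣m⇒m%n≡0 s N (∣m+n∣m⇒∣n N∣sr+s N∣sr)
      where
      r = (λ′ * a₁) % N
      N∣sr : N ∣ s * r
      N∣sr = m%n≡0⇒n∣m (s * r) N (begin
        (s * r) % N                 ≡⟨ [m*[o%N]]%N≡[m*o]%N s (λ′ * a₁) ⟩
        (s * (λ′ * a₁)) % N         ≡⟨ cong (_% N) (regroup s λ′ a₁) ⟩
        ((λ′ * s) * a₁) % N         ≡⟨ [m%N*o]%N≡[m*o]%N (λ′ * s) a₁ ⟨
        (((λ′ * s) % N) * a₁) % N   ≡⟨ cong (λ c → (c * a₁) % N) λ′s%N≡0 ⟩
        0 % N                       ≡⟨ m<n⇒m%n≡m (>-nonZero⁻¹ N) ⟩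
        0                           ∎)
        where
        open ≡-Reasoning
        regroup : ∀ s l a → s * (l * a) ≡ (l * s) * a
        regroup = solve-∀
      N∣sr+s : N ∣ s * r + s
      N∣sr+s = subst (N ∣_) (trans (cong (s *_) (sym λ′a₁≡-1)) (trans (*-suc s r) (+-comm s (s * r)))) (n∣m*n s)

    λ′-sum≡N⇒%≡0 : ∀ a b → (λ′ * a) % N + (λ′ * b) % N ≡ N → (a + b) % N ≡ 0
    λ′-sum≡N⇒%≡0 a b sum≡N = unit-cancel (a + b) (begin
      (λ′ * (a + b)) % N                    ≡⟨ cong (_% N) (*-distribˡ-+ λ′ a b) ⟩
      (λ′ * a + λ′ * b) % N                 ≡⟨ %-distribˡ-+ (λ′ * a) (λ′ * b) N ⟩
      ((λ′ * a) % N + (λ′ * b) % N) % N     ≡⟨ cong (_% N) sum≡N ⟩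
      N % N                                 ≡⟨ n%n≡0 N ⟩
      0                                     ∎)
      where open ≡-Reasoning

    -- Reindexing by k = jλ′ turns (k a₁)_N into N − j.
    ExceedsTriple⇒Exceeds : ∀ a₂ a₃ → ExceedsTriple a₁ a₂ a₃ → Exceeds N ((λ′ * a₂) % N) ((λ′ * a₃) % N)
    ExceedsTriple⇒Exceeds a₂ a₃ hyp j 0<j j<N = +-cancelˡ-< N j (X + Y) (begin-strict
      N + j                 ≡⟨ +-comm N j ⟩
      j + N                 <⟨ +-monoʳ-< j (hyp k 0<k (m%n<n (j * λ′) N)) ⟩
      j + (A₁ + A₂ + A₃)    ≡⟨ cong₂ (λ b c → j + (A₁ + b + c)) (reindex a₂) (reindex a₃) ⟩
      j + (A₁ + X + Y)      ≡⟨ regroup j A₁ X Y ⟩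
      (j + A₁) + (X + Y)    ≡⟨ cong (_+ (X + Y)) j+A₁≡N ⟩
      N + (X + Y)           ∎)
      where
      open ≤-Reasoning
      k = (j * λ′) % N
      A₁ = (k * a₁) % N
      A₂ = (k * a₂) % N
      A₃ = (k * a₃) % N
      X = (j * ((λ′ * a₂) % N)) % N
      Y = (j * ((λ′ * a₃) % N)) % N
      reindex : ∀ a → (k * a) % N ≡ (j * ((λ′ * a) % N)) % N
      reindex = [[jl]%N*a]%N≡[j*[la]%N]%N j λ′
      j+A₁≡N : j + A₁ ≡ N
      j+A₁≡N = trans (cong (j +_) (reindex a₁)) (j+[jr]%N≡N j ((λ′ * a₁) % N) λ′a₁≡-1 0<j j<N)
      0<k : 0 < k
      0<k = n≢0⇒n>0 λ k≡0 → <⇒≢ j<N (trans (sym (+-identityʳ j)) (trans (cong (j +_) (sym (A₁≡0 k≡0))) j+A₁≡N))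
        where
        A₁≡0 : k ≡ 0 → A₁ ≡ 0
        A₁≡0 k≡0 = trans (cong (λ c → (c * a₁) % N) k≡0) (m<n⇒m%n≡m (>-nonZero⁻¹ N))
      regroup : ∀ j a x y → j + (a + x + y) ≡ (j + a) + (x + y)
      regroup = solve-∀

    pair-sum-≡0 : ∀ a₂ a₃ → 2 ≤ N → ExceedsTriple a₁ a₂ a₃ →
                  (a₁ + a₂) % N ≡ 0 ⊎ (a₁ + a₃) % N ≡ 0 ⊎ (a₂ + a₃) % N ≡ 0
    pair-sum-≡0 a₂ a₃ 2≤N hyp with exceeds-only-trivially N 2≤N (λ′ * a₂ % N) (λ′ * a₃ % N)
                                     (m%n<n (λ′ * a₂) N) (m%n<n (λ′ * a₃) N) (ExceedsTriple⇒Exceeds a₂ a₃ hyp)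
    ... | inj₁ u≡1 = inj₁ (λ′-sum≡N⇒%≡0 a₁ a₂ (trans (cong ((λ′ * a₁) % N +_) u≡1) (trans (+-comm _ 1) λ′a₁≡-1)))
    ... | inj₂ (inj₁ v≡1) = inj₂ (inj₁ (λ′-sum≡N⇒%≡0 a₁ a₃ (trans (cong ((λ′ * a₁) % N +_) v≡1) (trans (+-comm _ 1) λ′a₁≡-1))))
    ... | inj₂ (inj₂ u+v≡N) = inj₂ (inj₂ (λ′-sum≡N⇒%≡0 a₂ a₃ u+v≡N))

-- Integer residues

open import Data.Integer using (ℤ; +_; -[1+_]; ∣_∣; _%ℕ_; _/ℕ_) renaming (_+_ to _+ℤ_; _*_ to _*ℤ_; -_ to -ℤ_; _-_ to _-ℤ_)
import Data.Integer.Properties as ℤ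
import Data.Integer.DivMod as ℤ
open import Data.Integer.Divisibility using () renaming (_∣_ to _∣ℤ_)
open import Data.Integer.Divisibility.Signed using (∣⇒∣ᵤ)
open import Data.Integer.GCD using (gcd)
open import Data.Nat.GCD using (module Bézout; GCD; gcd-GCD)
open import Data.Integer.Tactic.RingSolver using () renaming (solve-∀ to solve-∀ℤ)

module _ (N : ℕ) .{{_ : NonZero N}} where

  +r+sN≡+m⇒r≡m%N : ∀ {r m} s → r < N → + r +ℤ s *ℤ + N ≡ + m → r ≡ m % N
  +r+sN≡+m⇒r≡m%N {r} {m} (+ t) r<N eq = sym (m+pn≡r+qn⇒m%n≡r N 0 t r<N (trans (+-identityʳ m) (ℤ.+-injective (begin
    + m                 ≡⟨ eq ⟨
    + r +ℤ + t *ℤ + N   ≡⟨ cong (+ r +ℤ_) (ℤ.pos-* t N) ⟨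
    + r +ℤ + (t * N)    ≡⟨ ℤ.pos-+ r (t * N) ⟨
    + (r + t * N)       ∎))))
    where open ≡-Reasoning
  +r+sN≡+m⇒r≡m%N {r} {m} -[1+ t ] r<N eq = ⊥-elim (<-irrefl r≡m+[1+t]N (<-≤-trans r<N (≤-trans (m≤m+n N (t * N)) (m≤n+m _ m))))
    where
    open ≡-Reasoning
    r≡m+[1+t]N : r ≡ m + suc t * N
    r≡m+[1+t]N = ℤ.+-injective (begin
      + r                                         ≡⟨ cancel (+ r) (-[1+ t ] *ℤ + N) ⟩
      (+ r +ℤ -[1+ t ] *ℤ + N) +ℤ -ℤ (-[1+ t ] *ℤ + N) ≡⟨ cong₂ _+ℤ_ eq (ℤ.neg-distribˡ-* -[1+ t ] (+ N)) ⟩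
      + m +ℤ + suc t *ℤ + N                       ≡⟨ cong (+ m +ℤ_) (ℤ.pos-* (suc t) N) ⟨
      + m +ℤ + (suc t * N)                        ≡⟨ ℤ.pos-+ m (suc t * N) ⟨
      + (m + suc t * N)                           ∎)
      where
      cancel : ∀ a b → a ≡ (a +ℤ b) +ℤ -ℤ b
      cancel = solve-∀ℤ

  [+m+tN]%ℕN≡m%N : ∀ m t → (+ m +ℤ t *ℤ + N) %ℕ N ≡ m % N
  [+m+tN]%ℕN≡m%N m t = +r+sN≡+m⇒r≡m%N (a /ℕ N -ℤ t) (ℤ.n%ℕd<d a N) (begin
    + (a %ℕ N) +ℤ (a /ℕ N -ℤ t) *ℤ + N      ≡⟨ shift (+ (a %ℕ N)) (a /ℕ N) t (+ N) ⟩
    (+ (a %ℕ N) +ℤ a /ℕ N *ℤ + N) -ℤ t *ℤ + N ≡⟨ cong (_-ℤ t *ℤ + N) (ℤ.a≡a%ℕn+[a/ℕn]*n a N) ⟨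
    a -ℤ t *ℤ + N                            ≡⟨ shift′ (+ m) t (+ N) ⟩
    + m                                      ∎)
    where
    open ≡-Reasoning
    a = + m +ℤ t *ℤ + N
    shift : ∀ r q t n → r +ℤ (q -ℤ t) *ℤ n ≡ (r +ℤ q *ℤ n) -ℤ t *ℤ n
    shift = solve-∀ℤ
    shift′ : ∀ m t n → (m +ℤ t *ℤ n) -ℤ t *ℤ n ≡ m
    shift′ = solve-∀ℤ

  %ℕ-distrib-+ : ∀ x y → (x +ℤ y) %ℕ N ≡ (x %ℕ N + y %ℕ N) % N
  %ℕ-distrib-+ x y = begin
    (x +ℤ y) %ℕ N                                           ≡⟨ cong (_%ℕ N) (cong₂ _+ℤ_ (ℤ.a≡a%ℕn+[a/ℕn]*n x N) (ℤ.a≡a%ℕn+[a/ℕn]*n y N)) ⟩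
    ((+ a +ℤ q *ℤ + N) +ℤ (+ b +ℤ p *ℤ + N)) %ℕ N           ≡⟨ cong (_%ℕ N) (regroup (+ a) q (+ b) p (+ N)) ⟩
    (+ a +ℤ + b +ℤ (q +ℤ p) *ℤ + N) %ℕ N                    ≡⟨ cong (λ c → (c +ℤ (q +ℤ p) *ℤ + N) %ℕ N) (ℤ.pos-+ a b) ⟨
    (+ (a + b) +ℤ (q +ℤ p) *ℤ + N) %ℕ N                     ≡⟨ [+m+tN]%ℕN≡m%N (a + b) (q +ℤ p) ⟩
    (a + b) % N                                             ∎
    where
    open ≡-Reasoning
    a = x %ℕ N
    b = y %ℕ N
    q = x /ℕ N
    p = y /ℕ N
    regroup : ∀ a q b p n → (a +ℤ q *ℤ n) +ℤ (b +ℤ p *ℤ n) ≡ a +ℤ b +ℤ (q +ℤ p) *ℤ n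
    regroup = solve-∀ℤ

  %ℕ-distrib-* : ∀ x y → (x *ℤ y) %ℕ N ≡ ((x %ℕ N) * (y %ℕ N)) % N
  %ℕ-distrib-* x y = begin
    (x *ℤ y) %ℕ N                                           ≡⟨ cong (_%ℕ N) (cong₂ _*ℤ_ (ℤ.a≡a%ℕn+[a/ℕn]*n x N) (ℤ.a≡a%ℕn+[a/ℕn]*n y N)) ⟩
    ((+ a +ℤ q *ℤ + N) *ℤ (+ b +ℤ p *ℤ + N)) %ℕ N           ≡⟨ cong (_%ℕ N) (expand (+ a) q (+ b) p (+ N)) ⟩
    (+ a *ℤ + b +ℤ T *ℤ + N) %ℕ N                           ≡⟨ cong (λ c → (c +ℤ T *ℤ + N) %ℕ N) (ℤ.pos-* a b) ⟨
    (+ (a * b) +ℤ T *ℤ + N) %ℕ N                            ≡⟨ [+m+tN]%ℕN≡m%N (a * b) T ⟩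
    (a * b) % N                                             ∎
    where
    open ≡-Reasoning
    a = x %ℕ N
    b = y %ℕ N
    q = x /ℕ N
    p = y /ℕ N
    T = + a *ℤ p +ℤ q *ℤ + b +ℤ q *ℤ p *ℤ + N
    expand : ∀ a q b p n → (a +ℤ q *ℤ n) *ℤ (b +ℤ p *ℤ n) ≡ a *ℤ b +ℤ (a *ℤ p +ℤ q *ℤ b +ℤ q *ℤ p *ℤ n) *ℤ n
    expand = solve-∀ℤ

  %ℕ≡0⇒∣ : ∀ x → x %ℕ N ≡ 0 → + N ∣ℤ x
  %ℕ≡0⇒∣ x x%N≡0 = ∣⇒∣ᵤ (record { quotient = x /ℕ N ; equality = begin
    x                             ≡⟨ ℤ.a≡a%ℕn+[a/ℕn]*n x N ⟩
    + (x %ℕ N) +ℤ x /ℕ N *ℤ + N   ≡⟨ cong (λ r → + r +ℤ x /ℕ N *ℤ + N) x%N≡0 ⟩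
    + 0 +ℤ x /ℕ N *ℤ + N          ≡⟨ ℤ.+-identityˡ (x /ℕ N *ℤ + N) ⟩
    x /ℕ N *ℤ + N                 ∎ })
    where open ≡-Reasoning

  [+k*x]%ℕN≡[k*[x%ℕN]]%N : ∀ k x → (+ k *ℤ x) %ℕ N ≡ (k * (x %ℕ N)) % N
  [+k*x]%ℕN≡[k*[x%ℕN]]%N k x = trans (%ℕ-distrib-* (+ k) x) ([m%N*o]%N≡[m*o]%N N k (x %ℕ N))

  1+y≡TN⇒1+y%ℕN≡N : ∀ y T → + 1 +ℤ y ≡ T *ℤ + N → suc (y %ℕ N) ≡ N
  1+y≡TN⇒1+y%ℕN≡N y T 1+y≡TN = trans (cong suc y%ℕN≡pred-N) (suc-pred N)
    where
    open ≡-Reasoning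
    y%ℕN≡pred-N : y %ℕ N ≡ pred N
    y%ℕN≡pred-N = begin
      y %ℕ N                                     ≡⟨ cong (_%ℕ N) y≡ ⟩
      (+ pred N +ℤ (T -ℤ + 1) *ℤ + N) %ℕ N       ≡⟨ [+m+tN]%ℕN≡m%N (pred N) (T -ℤ + 1) ⟩
      pred N % N                                 ≡⟨ m<n⇒m%n≡m (subst (pred N <_) (suc-pred N) ≤-refl) ⟩
      pred N                                     ∎
      where
      y≡ : y ≡ + pred N +ℤ (T -ℤ + 1) *ℤ + N
      y≡ = begin
        y                                        ≡⟨ isolate (+ 1) y ⟩
        (+ 1 +ℤ y) -ℤ + 1                        ≡⟨ cong (_-ℤ + 1) 1+y≡TN ⟩
        T *ℤ + N -ℤ + 1                          ≡⟨ cong (λ c → T *ℤ c -ℤ + 1) +N≡1+pred-N ⟩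
        T *ℤ (+ 1 +ℤ + pred N) -ℤ + 1            ≡⟨ expand T (+ pred N) ⟩
        + pred N +ℤ (T -ℤ + 1) *ℤ (+ 1 +ℤ + pred N) ≡⟨ cong (λ c → + pred N +ℤ (T -ℤ + 1) *ℤ c) +N≡1+pred-N ⟨
        + pred N +ℤ (T -ℤ + 1) *ℤ + N            ∎
        where
        +N≡1+pred-N : + N ≡ + 1 +ℤ + pred N
        +N≡1+pred-N = trans (cong +_ (sym (suc-pred N))) (ℤ.pos-+ 1 (pred N))
        isolate : ∀ a y → y ≡ (a +ℤ y) -ℤ a
        isolate = solve-∀ℤ
        expand : ∀ T m → T *ℤ (+ 1 +ℤ m) -ℤ + 1 ≡ m +ℤ (T -ℤ + 1) *ℤ (+ 1 +ℤ m)
        expand = solve-∀ℤ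

  [x%ℕN+y%ℕN]%N≡0⇒N∣x+y : ∀ x y → (x %ℕ N + y %ℕ N) % N ≡ 0 → + N ∣ℤ x +ℤ y
  [x%ℕN+y%ℕN]%N≡0⇒N∣x+y x y sum≡0 = %ℕ≡0⇒∣ (x +ℤ y) (trans (%ℕ-distrib-+ x y) sum≡0)

+-*-homo : ∀ a b c d e → a + b * c ≡ d * e → + a +ℤ + b *ℤ + c ≡ + d *ℤ + e
+-*-homo a b c d e eq = begin
  + a +ℤ + b *ℤ + c   ≡⟨ cong (λ w → + a +ℤ w) (ℤ.pos-* b c) ⟨
  + a +ℤ + (b * c)    ≡⟨ ℤ.pos-+ a (b * c) ⟨
  + (a + b * c)       ≡⟨ cong +_ eq ⟩
  + (d * e)           ≡⟨ ℤ.pos-* d e ⟩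
  + d *ℤ + e          ∎
  where open ≡-Reasoning

bezout-unsign : ∀ x L T n → + 1 +ℤ L *ℤ + ∣ x ∣ ≡ T *ℤ n → ∃ λ L′ → ∃ λ T′ → + 1 +ℤ L′ *ℤ x ≡ T′ *ℤ n
bezout-unsign x L T n eq with ℤ.+∣i∣≡i⊎+∣i∣≡-i x
... | inj₁ ∣x∣≡x = L , T , subst (λ y → + 1 +ℤ L *ℤ y ≡ T *ℤ n) ∣x∣≡x eq
... | inj₂ ∣x∣≡-x = -ℤ L , T , trans (cong (λ w → + 1 +ℤ w) (trans (swap L x) (cong (L *ℤ_) (sym ∣x∣≡-x)))) eq
  where
  swap : ∀ a b → (-ℤ a) *ℤ b ≡ a *ℤ (-ℤ b)
  swap = solve-∀ℤ

gcd≡1⇒bezout : ∀ N x → gcd x (+ N) ≡ + 1 → ∃ λ L → ∃ λ T → + 1 +ℤ L *ℤ x ≡ T *ℤ + N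
gcd≡1⇒bezout N x gcd≡1 with Bézout.identity (subst (GCD ∣ x ∣ N) (ℤ.+-injective gcd≡1) (gcd-GCD ∣ x ∣ N))
... | Bézout.-+ s t eq = bezout-unsign x (+ s) (+ t) (+ N) (+-*-homo 1 s ∣ x ∣ t N eq)
... | Bézout.+- s t eq = bezout-unsign x (-ℤ + s) (-ℤ + t) (+ N) (begin
  + 1 +ℤ (-ℤ + s) *ℤ + ∣ x ∣    ≡⟨ negate (+ 1) (+ s) (+ ∣ x ∣) ⟩
  + 1 -ℤ + s *ℤ + ∣ x ∣         ≡⟨ cong (λ w → + 1 -ℤ w) (+-*-homo 1 t N s ∣ x ∣ eq) ⟨
  + 1 -ℤ (+ 1 +ℤ + t *ℤ + N)    ≡⟨ cancel (+ 1) (+ t) (+ N) ⟩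
  (-ℤ + t) *ℤ + N               ∎)
  where
  open ≡-Reasoning
  negate : ∀ a s x → a +ℤ (-ℤ s) *ℤ x ≡ a -ℤ s *ℤ x
  negate = solve-∀ℤ
  cancel : ∀ a t n → a -ℤ (a +ℤ t *ℤ n) ≡ (-ℤ t) *ℤ n
  cancel = solve-∀ℤ

lemma2p4 : (n : ℕ) → 2 ≤ n → (x₁ x₂ x₃ : ℤ)
    → gcd x₁ (+ n) ≡ + 1 → gcd x₂ (+ n) ≡ + 1 → gcd x₃ (+ n) ≡ + 1
    → ((k : ℕ) → 1 ≤ k → k < n
        → n < res (+ k *ℤ x₁) n + res (+ k *ℤ x₂) n + res (+ k *ℤ x₃) n)
    → (+ n ∣ℤ x₁ +ℤ x₂) ⊎ (+ n ∣ℤ x₁ +ℤ x₃) ⊎ (+ n ∣ℤ x₂ +ℤ x₃)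
lemma2p4 (suc zero) (s≤s ())
lemma2p4 n@(suc (suc _)) 2≤n x₁ x₂ x₃ gcd₁≡1 _ _ hyp with gcd≡1⇒bezout n x₁ gcd₁≡1
... | L , T , 1+Lx₁≡Tn =
  Sum.map (n∣ x₁ x₂) (Sum.map (n∣ x₁ x₃) (n∣ x₂ x₃))
    (pair-sum-≡0 n (L %ℕ n) (x₁ %ℕ n) λa₁≡-1 (x₂ %ℕ n) (x₃ %ℕ n) 2≤n hyp′)
  where
  n∣ : ∀ x y → (x %ℕ n + y %ℕ n) % n ≡ 0 → + n ∣ℤ x +ℤ y
  n∣ = [x%ℕN+y%ℕN]%N≡0⇒N∣x+y n
  λa₁≡-1 : suc (((L %ℕ n) * (x₁ %ℕ n)) % n) ≡ n
  λa₁≡-1 = trans (cong suc (sym (%ℕ-distrib-* n L x₁))) (1+y≡TN⇒1+y%ℕN≡N n (L *ℤ x₁) T 1+Lx₁≡Tn)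
  hyp′ : ExceedsTriple n (x₁ %ℕ n) (x₂ %ℕ n) (x₃ %ℕ n)
  hyp′ k 1≤k k<n = subst (n <_) (cong₂ _+_ (cong₂ _+_ (res≡ x₁) (res≡ x₂)) (res≡ x₃)) (hyp k 1≤k k<n)
    where
    res≡ : ∀ x → res (+ k *ℤ x) n ≡ (k * (x %ℕ n)) % n
    res≡ = [+k*x]%ℕN≡[k*[x%ℕN]]%N n k
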